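{- Let $\overrightarrow{G}=\overrightarrow{G}(V,E)$ be a 2-qBMG. If two vertices $x,y$ lie in the same $\mathrm{Aut}_I(\overrightarrow{G})$-orbit and have a common out-neighbor, then $x$ and $y$ are equivalent, i.e. $N^+(x)=N^+(y)$ and $N^-(x)=N^-(y)$.
   Context: A digraph $\overrightarrow{G}=\overrightarrow{G}(V,E)$ has a finite vertex set $V$ and edge set $E\subseteq V\times V$ without loops ($uv$ denotes the edge with tail $u$ and head $v$; symmetric edges allowed). $N^+(v)=\{w:vw\in E\}$, $N^-(v)=\{w:wv\in E\}$. Two vertices $u,v$ are independent if neither $uv$ nor $vu$ is in $E$. A 2-qBMG is a digraph, equipped with a partition $V=U\cup W$ into two color classes such that every edge joins a vertex of $U$ and a vertex of $W$, satisfying: (N1) if $u,v$ are independent then there are no vertices $w,t$ with $ut,vw,tw\in E$; (N2) if $uv,vw,wt\in E$ then $ut\in E$; (N3) if $u,v$ have a common out-neighbor then $N^+(u)\subseteq N^+(v)$ or $N^+(v)\subseteq N^+(u)$. An automorphism is a permutation $\pi$ of $V$ with $xy\in E\Rightarrow\pi(x)\pi(y)\in E$; $\mathrm{Aut}_I(\overrightarrow{G})$ is the group of automorphisms mapping $U$ to $U$ and $W$ to $W$. -}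

module Defs where

open import Data.Nat using (ℕ)
open import Data.Fin using (Fin)
open import Data.Bool using (Bool; T)
open import Data.Product using (_×_; ∃; ∃-syntax; _,_)
open import Data.Sum using (_⊎_)
open import Data.Empty using (⊥)
open import Relation.Nullary using (¬_)
open import Relation.Binary.PropositionalEquality using (_≡_)
open import Function.Bundles using (_↔_; Inverse; _⇔_)

record Digraph (n : ℕ) : Set where
  field
    edge   : Fin n → Fin n → Bool
    noLoop : ∀ v → ¬ T (edge v v)

module _ {n : ℕ} (G : Digraph n) where
  open Digraph G

  _⟶_ : Fin n → Fin n → Set
  u ⟶ v = T (edge u v)

  Independent : Fin n → Fin n → Set
  Independent u v = ¬ (u ⟶ v) × ¬ (v ⟶ u)

  OutSub : Fin n → Fin n → Set
  OutSub u v = ∀ w → u ⟶ w → v ⟶ w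

  -- A 2-qBMG w.r.t. the colouring col : V → Bool  (U = col⁻¹ true, W = col⁻¹ false)
  record Is2qBMG (col : Fin n → Bool) : Set where
    field
      proper : ∀ u v → u ⟶ v → ¬ (col u ≡ col v)
      N1 : ∀ u v w t → Independent u v → ¬ (u ⟶ t × v ⟶ w × t ⟶ w)
      N2 : ∀ u v w t → u ⟶ v → v ⟶ w → w ⟶ t → u ⟶ t
      N3 : ∀ u v → (∃[ w ] (u ⟶ w × v ⟶ w)) → OutSub u v ⊎ OutSub v u

  record IsAutI (col : Fin n → Bool) (π : Fin n ↔ Fin n) : Set where
    open Inverse π using (to)
    field
      preservesEdges  : ∀ x y → x ⟶ y → to x ⟶ to y
      preservesColour : ∀ x → col (to x) ≡ col x

  SameOrbit : (col : Fin n → Bool) → Fin n → Fin n → Set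
  SameOrbit col x y = ∃[ π ] (IsAutI col π × Inverse.to π x ≡ y)

  Equivalent : Fin n → Fin n → Set
  Equivalent x y = (∀ w → (x ⟶ w) ⇔ (y ⟶ w)) × (∀ w → (w ⟶ x) ⇔ (w ⟶ y))

{-# OPTIONS --safe #-}
module Submission where

-- An automorphism σ with σ x = y is an edge-preserving injection of a finite set, so some
-- power of σ maps y back to x.  For an injection f of a finite set, f[B] ⊆ A ⊆ B forces
-- B ⊆ A, since every point of B returns to itself along its f-orbit; hence nested
-- neighbourhoods of x and y are equal.  Out-neighbourhoods are nested by (N3).  For
-- in-neighbourhoods: if z → x but z ↛ y, every in-neighbour v of y is one of x, through
-- v → y → z → x and (N2) when y → z, while otherwise z, y are independent and
-- z → x → w ← y contradicts (N1).

open import Defs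
open import Data.Nat using (ℕ; zero; suc; _+_)
open import Data.Nat.Properties using (+-suc; m≤n⇒∃[o]m+o≡n; n<1+n)
open import Data.Fin using (Fin; toℕ)
open import Data.Fin.Properties using (pigeonhole; any?)
open import Data.Bool using (Bool)
open import Data.Product using (_×_; ∃-syntax; _,_)
open import Data.Sum using (_⊎_; inj₁; inj₂)
open import Data.Empty using (⊥-elim)
open import Function.Base using (flip)
open import Function.Bundles using (Inverse; Injection; _⇔_; mk⇔)
open import Function.Definitions using (Injective)
open import Function.Properties.Inverse using (↔⇒↣)
open import Level using (0ℓ)
open import Relation.Binary.Core using (Rel; _=[_]⇒_)
open import Relation.Binary.PropositionalEquality
  using (_≡_; refl; cong; cong-app; subst; module ≡-Reasoning)
open import Relation.Nullary using (¬_; yes; no)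
open import Relation.Nullary.Decidable using (T?; decidable-stable; _×-dec_; ¬?)
open import Relation.Unary using (Pred; _⊆′_; _≐′_)

≐′⇒⇔ : {A : Set} {P Q : Pred A 0ℓ} → P ≐′ Q → ∀ x → P x ⇔ Q x
≐′⇒⇔ (P⊆Q , Q⊆P) x = mk⇔ (P⊆Q x) (Q⊆P x)

module _ {n : ℕ} where

  open import Function.Endo.Propositional (Fin n) using (_^_; ^-homo)
  open ≡-Reasoning

  ^-sucʳ : (f : Fin n → Fin n) (k : ℕ) (z : Fin n) → (f ^ suc k) z ≡ (f ^ k) (f z)
  ^-sucʳ f zero    z = refl
  ^-sucʳ f (suc k) z = cong f (^-sucʳ f k z)

  ^-injective : {f : Fin n → Fin n} → Injective _≡_ _≡_ f → ∀ k → Injective _≡_ _≡_ (f ^ k)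
  ^-injective inj zero            eq = eq
  ^-injective inj (suc k) {x} {y} eq = ^-injective inj k {x} {y} (inj eq)

  ^-preserves : {R : Rel (Fin n) 0ℓ} {f : Fin n → Fin n} → R =[ f ]⇒ R → ∀ k → R =[ f ^ k ]⇒ R
  ^-preserves         pres zero    r = r
  ^-preserves {R} {f} pres (suc k) r = pres (^-preserves {R} {f} pres k r)

  -- Two of z, f z, …, fⁿ z coincide by pigeonhole; injectivity of fⁱ cancels the common prefix.
  injective⇒periodic : {f : Fin n → Fin n} → Injective _≡_ _≡_ f → ∀ z → ∃[ p ] (f ^ suc p) z ≡ z
  injective⇒periodic {f} inj z with pigeonhole (n<1+n n) (λ i → (f ^ toℕ i) z)
  ... | i , j , i<j , fⁱz≡fʲz with m≤n⇒∃[o]m+o≡n i<j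
  ... | d , 1+i+d≡j = d , ^-injective inj (toℕ i) (begin
    (f ^ toℕ i) ((f ^ suc d) z)  ≡⟨ cong-app (^-homo f (toℕ i) (suc d)) z ⟨
    (f ^ (toℕ i + suc d)) z      ≡⟨ cong (λ k → (f ^ k) z) (+-suc (toℕ i) d) ⟩
    (f ^ suc (toℕ i + d)) z      ≡⟨ cong (λ k → (f ^ k) z) 1+i+d≡j ⟩
    (f ^ toℕ j) z                ≡⟨ fⁱz≡fʲz ⟨
    (f ^ toℕ i) z                ∎)

  ⊆′⇒⊇′-by-injection : {f : Fin n → Fin n} → Injective _≡_ _≡_ f → {A B : Pred (Fin n) 0ℓ} →
    (∀ w → B w → A (f w)) → A ⊆′ B → B ⊆′ A
  ⊆′⇒⊇′-by-injection {f} inj {A} {B} f[B]⊆A A⊆B w w∈B with injective⇒periodic inj w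
  ... | p , fᵖ⁺¹w≡w = subst A fᵖ⁺¹w≡w (orbit⊆A p)
    where
    orbit⊆A : ∀ k → A ((f ^ suc k) w)
    orbit⊆A zero    = f[B]⊆A w w∈B
    orbit⊆A (suc k) = f[B]⊆A _ (A⊆B _ (orbit⊆A k))

  Nested : Pred (Fin n) 0ℓ → Pred (Fin n) 0ℓ → Set
  Nested A B = A ⊆′ B ⊎ B ⊆′ A

  nested⇒≐′ : {f g : Fin n → Fin n} → Injective _≡_ _≡_ f → Injective _≡_ _≡_ g →
    {A B : Pred (Fin n) 0ℓ} → (∀ w → A w → B (f w)) → (∀ w → B w → A (g w)) →
    Nested A B → A ≐′ B
  nested⇒≐′ f-inj g-inj f[A]⊆B g[B]⊆A (inj₁ A⊆B) = A⊆B , ⊆′⇒⊇′-by-injection g-inj g[B]⊆A A⊆B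
  nested⇒≐′ f-inj g-inj f[A]⊆B g[B]⊆A (inj₂ B⊆A) = ⊆′⇒⊇′-by-injection f-inj f[A]⊆B B⊆A , B⊆A

  nested-neighbourhoods-≐′ : (R : Rel (Fin n) 0ℓ) {f : Fin n → Fin n} → Injective _≡_ _≡_ f →
    R =[ f ]⇒ R → ∀ {x y} → f x ≡ y → Nested (R x) (R y) → R x ≐′ R y
  nested-neighbourhoods-≐′ R {f} inj pres {x} {y} fx≡y with injective⇒periodic inj x
  ... | p , fᵖ⁺¹x≡x =
    nested⇒≐′ inj (^-injective inj p)
      (maps-into pres fx≡y) (maps-into (^-preserves {R} {f} pres p) fᵖy≡x)
    where
    maps-into : {g : Fin n → Fin n} → R =[ g ]⇒ R → ∀ {u v} → g u ≡ v → ∀ w → R u w → R v (g w)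
    maps-into {g} g-pres gu≡v w r = subst (λ v → R v (g w)) gu≡v (g-pres r)

    fᵖy≡x : (f ^ p) y ≡ x
    fᵖy≡x = begin
      (f ^ p) y        ≡⟨ cong (f ^ p) fx≡y ⟨
      (f ^ p) (f x)    ≡⟨ ^-sucʳ f p x ⟨
      (f ^ suc p) x    ≡⟨ fᵖ⁺¹x≡x ⟩
      x                ∎

module _ {n : ℕ} (G : Digraph n) where

  N⁻ : Fin n → Pred (Fin n) 0ℓ
  N⁻ x w = _⟶_ G w x

module _ {n : ℕ} (G : Digraph n) {col : Fin n → Bool} (qbmg : Is2qBMG G col) where

  open Digraph G using (edge)
  open Is2qBMG qbmg using (N1; N2)

  N⁻-⊆′-of-missed-in-neighbour : ∀ {a b w z} → _⟶_ G a w → _⟶_ G b w →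
    _⟶_ G z a → ¬ _⟶_ G z b → N⁻ G b ⊆′ N⁻ G a
  N⁻-⊆′-of-missed-in-neighbour {a} {b} {w} {z} a⟶w b⟶w z⟶a ¬z⟶b v v⟶b with T? (edge b z)
  ... | yes b⟶z = N2 v b z a v⟶b b⟶z z⟶a
  ... | no ¬b⟶z = ⊥-elim (N1 z b w a (¬z⟶b , ¬b⟶z) (z⟶a , b⟶w , a⟶w))

  N⁻-nested : ∀ {x y} → ∃[ w ] (_⟶_ G x w × _⟶_ G y w) → Nested (N⁻ G x) (N⁻ G y)
  N⁻-nested {x} {y} (w , x⟶w , y⟶w) with any? (λ z → T? (edge z x) ×-dec ¬? (T? (edge z y)))
  ... | yes (z , z⟶x , ¬z⟶y) = inj₂ (N⁻-⊆′-of-missed-in-neighbour x⟶w y⟶w z⟶x ¬z⟶y)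
  ... | no ∄z = inj₁ λ z z⟶x → decidable-stable (T? (edge z y)) λ ¬z⟶y → ∄z (z , z⟶x , ¬z⟶y)

proposition5p1 : (n : ℕ) (G : Digraph n) (col : Fin n → Bool) → Is2qBMG G col →
    (x y : Fin n) → SameOrbit G col x y → (∃[ w ] (_⟶_ G x w × _⟶_ G y w)) →
    Equivalent G x y
proposition5p1 n G col qbmg x y (π , aut , σx≡y) common =
    ≐′⇒⇔ (nested-neighbourhoods-≐′ (_⟶_ G) σ-inj σ-pres σx≡y (N3 x y common))
  , ≐′⇒⇔ (nested-neighbourhoods-≐′ (flip (_⟶_ G)) σ-inj σ-pres σx≡y (N⁻-nested G qbmg common))
  where
  open Is2qBMG qbmg using (N3)

  σ-inj : Injective _≡_ _≡_ (Inverse.to π)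
  σ-inj = Injection.injective (↔⇒↣ π)

  σ-pres : _⟶_ G =[ Inverse.to π ]⇒ _⟶_ G
  σ-pres = IsAutI.preservesEdges aut _ _
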